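{- Assume that $F(0,Y)$ is not identically $0$. Then the quantity $r$ satisfies \[ r=\sum_{\kappa_i>0}\min\{1, \kappa_i/e_i\}, \] where the sum extends only over those indices $i\in\{1,\ldots,n\}$ for which $\kappa_i>0$.
   Context: Let $\mathbb{K}$ be a field of characteristic $0$ and let $F(X,Y)=f_n(X)Y^n+\cdots+f_0(X)\in \mathbb{K}[X,Y]$ be a polynomial of $Y$-degree $n$. By the Theorem of Puiseux, there exist a finite extension $\mathbb{L}$ of $\mathbb{K}$, positive integers $e_1,\ldots,e_n$, all not exceeding $n$, and series $y_i\in \mathbb{L}((x^{1/e_i}))$ such that $F(x,Y)=f_n(x)(Y-y_1)\cdots(Y-y_n)$. Write $y_i=\sum_{k=\kappa_i}^\infty a_{ik}x^{k/e_i}$ with $a_{i\kappa_i}\neq 0$ (so $\kappa_i/e_i$ is the $x$-adic valuation of $y_i$). Let $r$ be the order of vanishing of $F$ at $(0,0)$: \[ r=\min\left\{i+j: \frac{\partial^{i+j}F}{\partial X^i\partial Y^j}(0,0)\neq 0\right\}. \] -}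

module Defs where

open import Level using (Level; _⊔_)
open import Algebra.Bundles using (CommutativeRing)
open import Algebra.Morphism.Structures using (module RingMorphisms)
open import Data.Nat as ℕ using (ℕ; zero; suc; _≤_; _<_; _∸_)
open import Data.Nat.DivMod using (_/_; _%_)
open import Data.Integer as ℤ using (ℤ; +_; -[1+_])
open import Data.Rational as ℚ using (ℚ; 0ℚ; 1ℚ; _⊓_)
open import Data.Fin using (Fin; toℕ) renaming (zero to fzero; suc to fsuc)
open import Data.Maybe using (Maybe; just; nothing)
open import Data.Product using (Σ; ∃; ∃₂; _×_; _,_)
open import Data.Sum using (_⊎_)
open import Relation.Nullary using (¬_)
open import Relation.Binary.PropositionalEquality using (_≡_)

iter : ∀ {a} {A : Set a} → ℕ → (A → A) → A → A
iter zero f x = x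
iter (suc n) f x = f (iter n f x)

prodFinℕ : ∀ {m} → (Fin m → ℕ) → ℕ
prodFinℕ {zero} f = 1
prodFinℕ {suc m} f = f fzero ℕ.* prodFinℕ (λ i → f (fsuc i))

sumFinℚ : ∀ {m} → (Fin m → ℚ) → ℚ
sumFinℚ {zero} f = 0ℚ
sumFinℚ {suc m} f = f fzero ℚ.+ sumFinℚ (λ i → f (fsuc i))

-- E / e  (exact quotient when e ∣ E; e = 0 never occurs below)
quot : ℕ → ℕ → ℕ
quot E zero = 0
quot E (suc m) = E / suc m

-- the rational number k / e  (e ≥ 1 in all uses)
frac : ℤ → ℕ → ℚ
frac k zero = 0ℚ
frac k (suc m) = k ℚ./ suc m

module _ {c ℓ} (R : CommutativeRing c ℓ) where
  open CommutativeRing R using (Carrier; _≈_; _+_; _*_; -_; 0#; 1#)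

  _·_ : ℕ → Carrier → Carrier
  zero · x = 0#
  suc n · x = x + n · x

  IsField : Set (c ⊔ ℓ)
  IsField = ¬ (1# ≈ 0#) × (∀ x → ¬ (x ≈ 0#) → ∃ λ y → x * y ≈ 1#)

  CharacteristicZero : Set ℓ
  CharacteristicZero = ∀ m → ¬ (suc m · 1# ≈ 0#)

  sumℕ : ℕ → (ℕ → Carrier) → Carrier
  sumℕ zero f = 0#
  sumℕ (suc m) f = f 0 + sumℕ m (λ k → f (suc k))

  sumFin : ∀ {m} → (Fin m → Carrier) → Carrier
  sumFin {zero} f = 0#
  sumFin {suc m} f = f fzero + sumFin (λ i → f (fsuc i))

  -- Bivariate polynomials F = Σ F i j X^i Y^j, given by coefficient
  -- functions ℕ → ℕ → Carrier (finite support imposed as a hypothesis).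

  Coeffs2 : Set c
  Coeffs2 = ℕ → ℕ → Carrier

  ∂X : Coeffs2 → Coeffs2
  ∂X F i j = suc i · F (suc i) j

  ∂Y : Coeffs2 → Coeffs2
  ∂Y F i j = suc j · F i (suc j)

  derivAt00 : ℕ → ℕ → Coeffs2 → Carrier
  derivAt00 i j F = iter i ∂X (iter j ∂Y F) 0 0

  IsOrderAtOrigin : Coeffs2 → ℕ → Set ℓ
  IsOrderAtOrigin F r =
    (∃₂ λ i j → (i ℕ.+ j ≡ r) × ¬ (derivAt00 i j F ≈ 0#)) ×
    (∀ i j → ¬ (derivAt00 i j F ≈ 0#) → r ≤ i ℕ.+ j)

  -- Formal Laurent series in a variable t, bounded below:
  -- Σ_{k ≥ 0} coef k · t^(low + k)

  record LSer : Set c where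
    constructor lser
    field
      low  : ℤ
      coef : ℕ → Carrier
  open LSer public

  coefAt : LSer → ℤ → Carrier
  coefAt s z with z ℤ.- low s
  ... | + k = coef s k
  ... | -[1+ _ ] = 0#

  zeroS : LSer
  zeroS = lser (+ 0) (λ _ → 0#)

  oneS : LSer
  oneS = lser (+ 0) (λ { zero → 1# ; (suc _) → 0# })

  negS : LSer → LSer
  negS s = lser (low s) (λ k → - coef s k)

  addS : LSer → LSer → LSer
  addS s u = lser l (λ k → coefAt s (l ℤ.+ + k) + coefAt u (l ℤ.+ + k))
    where l = low s ℤ.⊓ low u

  mulS : LSer → LSer → LSer
  mulS s u = lser (low s ℤ.+ low u)
                  (λ k → sumℕ (suc k) (λ j → coef s j * coef u (k ∸ j)))

  -- substitution t ↦ t^d : a series in x^(1/e) viewed in x^(1/(d e))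
  spread : ℕ → LSer → LSer
  spread zero s = s
  spread (suc d) s =
    lser (low s ℤ.* + suc d)
         (λ k → pick (k % suc d) (k / suc d))
    where
    pick : ℕ → ℕ → Carrier
    pick zero q = coef s q
    pick (suc _) q = 0#

  -- Coefficients (in Y) of ∏_{i} (Y - y i), a polynomial in Y with
  -- Laurent-series coefficients; the result maps j to the coefficient of Y^j.
  prodLin : ∀ {m} → (Fin m → LSer) → ℕ → LSer
  prodLin {zero} ys zero = oneS
  prodLin {zero} ys (suc j) = zeroS
  prodLin {suc m} ys zero = negS (mulS (ys fzero) (prodLin (λ i → ys (fsuc i)) zero))
  prodLin {suc m} ys (suc j) =
    addS (prodLin (λ i → ys (fsuc i)) j)
         (negS (mulS (ys fzero) (prodLin (λ i → ys (fsuc i)) (suc j))))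

  -- The Puiseux series  y = Σ_{k ≥ 0} a k · x^((κ + k)/e)  as a series in
  -- t = x^(1/e); κ = nothing encodes y = 0 (valuation +∞).
  rootSer : Maybe ℤ → (ℕ → Carrier) → LSer
  rootSer nothing a = zeroS
  rootSer (just κ) a = lser κ a

module _ {c₁ ℓ₁ c₂ ℓ₂} (K : CommutativeRing c₁ ℓ₁) (L : CommutativeRing c₂ ℓ₂) where
  private
    module K = CommutativeRing K
    module L = CommutativeRing L

  IsFiniteFieldExtension : (K.Carrier → L.Carrier) → Set (c₁ ⊔ ℓ₁ ⊔ c₂ ⊔ ℓ₂)
  IsFiniteFieldExtension φ =
    IsField L ×
    RingMorphisms.IsRingHomomorphism K.rawRing L.rawRing φ ×
    (∃ λ m → Σ (Fin m → L.Carrier) λ b →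
       ∀ z → ∃ λ (cs : Fin m → K.Carrier) → z L.≈ sumFin L (λ j → φ (cs j) L.* b j))

  -- The Puiseux factorization  F(x,Y) = f_n(x) (Y - y_1) ⋯ (Y - y_n)
  -- with y_i = Σ_k a_i k x^((κ_i + k)/e_i)  (y_i = 0 when κ_i = nothing),
  -- checked coefficientwise in L((x^(1/E))), E = e_1 ⋯ e_n.
  IsPuiseuxFactorization :
    (φ : K.Carrier → L.Carrier) (n : ℕ) (F : Coeffs2 K)
    (e : Fin n → ℕ) (κ : Fin n → Maybe ℤ) (a : Fin n → ℕ → L.Carrier) →
    Set ℓ₂
  IsPuiseuxFactorization φ n F e κ a =
    (∀ i → 1 ≤ e i × e i ≤ n) ×
    (∀ i k → κ i ≡ just k → ¬ (a i 0 L.≈ L.0#)) ×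
    (∀ j z → coefAt L (Fx j) z L.≈ coefAt L (mulS L (Fx n) (prodLin L ys j)) z)
    where
    E : ℕ
    E = prodFinℕ e
    Fx : ℕ → LSer L
    Fx j = spread L E (lser (+ 0) (λ k → φ (F k j)))
    ys : Fin n → LSer L
    ys i = spread L (quot E (e i)) (rootSer L (κ i) (a i))

-- The summand  min{1, κ_i/e_i}  if κ_i > 0, and 0 otherwise
-- (κ = nothing, i.e. y_i = 0 with valuation +∞, contributes min{1,∞} = 1).

contribution : ℕ → Maybe ℤ → ℚ
contribution e nothing = 1ℚ
contribution e (just (+ suc m)) = 1ℚ ⊓ frac (+ suc m) e
contribution e (just (+ zero)) = 0ℚ
contribution e (just -[1+ _ ]) = 0ℚ

{-# OPTIONS --safe #-}
module Submission where

-- Put t = x^(1/M) with M the product of the e_i, so that F(x, Y) and all y_i have coefficients in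
-- L((t)). Give Y the weight s and let ord_s (Σ_j Q_j Y^j) = min_j (ord Q_j + s·j). By Gauss's lemma
-- ord_s is additive on products, and ord_s (Y − y) = min(s, ord y); hence
-- ord_s F = ord f_n + Σ_i min(s, ord y_i). For s = M the left side is M·r, the order at the origin,
-- and for s = 0 it is 0 because F(0, Y) ≠ 0. Subtracting, M·r = Σ_i (min(M, ord y_i) − min(0, ord y_i)),
-- and with ord y_i = M·κ_i/e_i each term is M·min{1, κ_i/e_i} if κ_i > 0 and 0 otherwise.

open import Defs
open import Level using (_⊔_)
open import Algebra.Bundles using (CommutativeRing)
open import Algebra.Morphism.Structures using (module RingMorphisms)
open import Data.Nat as ℕ using (ℕ; zero; suc; _<_)
import Data.Nat.Properties as ℕP
open import Data.Nat.Divisibility using (_∣_; divides; ∣-trans; n∣m*n; m∣m*n)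
open import Data.Nat.DivMod using (m≡m%n+[m/n]*n; m*n%n≡0; m*n/n≡m)
open import Data.Integer as Z using (ℤ; +_; -[1+_])
open Z using ()
  renaming (_+_ to _+ℤ_; _*_ to _*ℤ_; _-_ to _-ℤ_; _<_ to _<ℤ_; _≤_ to _≤ℤ_; -_ to -ℤ_; _⊓_ to _⊓ℤ_)
import Data.Integer.Properties as ℤP
open import Data.Integer.Tactic.RingSolver using (solve-∀)
open import Data.Rational as ℚ using (ℚ; 1ℚ; _/_)
import Data.Rational.Properties as ℚP
import Data.Rational.Unnormalised as ℚᵘ
import Data.Rational.Unnormalised.Properties as ℚᵘP
open import Data.Fin using (Fin) renaming (zero to fzero; suc to fsuc)
open import Data.Maybe using (Maybe; just; nothing)
open import Data.Product using (∃; ∃₂; _×_; _,_; proj₁; proj₂)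
open import Data.Sum using (_⊎_; inj₁; inj₂)
open import Data.Empty using (⊥-elim)
open import Relation.Nullary using (¬_; yes; no)
open import Function.Base using (_∘_)
open import Function.Bundles using (_⇔_; mk⇔; Equivalence)
open import Function.Construct.Composition using (_⇔-∘_)
open import Relation.Nullary.Decidable using (decidable-stable)
open import Relation.Binary.Definitions using (tri<; tri≈; tri>)
open import Relation.Binary.PropositionalEquality as P using (_≡_)
open import Algebra.Properties.CommutativeMonoid.Sum ℤP.+-0-commutativeMonoid using (sum)
open import Algebra.Properties.AbelianGroup ℤP.+-0-abelianGroup using () renaming (∙-cancelˡ to +-cancelˡ)

+≡+-<ˡ⇒>ʳ : ∀ x y a b → x +ℤ y ≡ a +ℤ b → a <ℤ x → y <ℤ b
+≡+-<ˡ⇒>ʳ x y a b eq a<x = ℤP.≰⇒> λ b≤y → ℤP.<-irrefl (P.sym eq) (ℤP.+-mono-<-≤ a<x b≤y)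

+<+-≤ˡ⇒<ʳ : ∀ x y a b → x +ℤ y <ℤ a +ℤ b → a ≤ℤ x → y <ℤ b
+<+-≤ˡ⇒<ʳ x y a b lt a≤x = ℤP.≰⇒> λ b≤y → ℤP.<⇒≱ lt (ℤP.+-mono-≤ a≤x b≤y)

-- The predicate need not be decidable, so the least counterexample exists only up to double negation.
least-counterexample : ∀ {p} (Q : ℕ → Set p) → ¬ (∀ k → Q k) → ∀ B → (∀ k → B < k → Q k) →
                       ¬ ¬ (∃ λ k → ¬ Q k × (∀ k′ → k′ < k → Q k′))
least-counterexample Q ¬all B Q-beyond-B ¬least = least-below (suc B) λ
  { (inj₁ Q-upto-B) → ¬all (everywhere Q-upto-B)
  ; (inj₂ least) → ¬least least }
  where
  everywhere : (∀ k → k < suc B → Q k) → ∀ k → Q k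
  everywhere Q-upto-B k with k ℕ.≤? B
  ... | yes k≤B = Q-upto-B k (ℕ.s≤s k≤B)
  ... | no k≰B = Q-beyond-B k (ℕP.≰⇒> k≰B)
  least-below : ∀ N → ¬ ¬ ((∀ k → k < N → Q k) ⊎ (∃ λ k → ¬ Q k × (∀ k′ → k′ < k → Q k′)))
  least-below zero ¬goal = ¬goal (inj₁ λ _ ())
  least-below (suc N) ¬goal = least-below N λ
    { (inj₂ least) → ¬goal (inj₂ least)
    ; (inj₁ Q-below-N) → ¬goal (inj₂ (N , (λ Q-N → ¬goal (inj₁ (extend Q-below-N Q-N))) , Q-below-N)) }
    where
    extend : (∀ k → k < N → Q k) → Q N → ∀ k → k < suc N → Q k
    extend Q-below-N Q-N k k<1+N with ℕP.m<1+n⇒m<n∨m≡n k<1+N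
    ... | inj₁ k<N = Q-below-N k k<N
    ... | inj₂ P.refl = Q-N

-- Coefficients of bounded-below Laurent series

-- spread 0 is the identity, so spread d scales exponents by spreadFactor d.
spreadFactor : ℕ → ℕ
spreadFactor zero = 1
spreadFactor (suc d) = suc d

-- The exponent nothing stands for +∞.
minScaled : ℤ → ℕ → Maybe ℤ → ℤ
minScaled s q nothing = s
minScaled s q (just k) = s ⊓ℤ (k *ℤ + q)

module Series {c ℓ} (L : CommutativeRing c ℓ) where
  open CommutativeRing L
  open import Algebra.Properties.Ring ring using (-0#≈0#; -‿involutive)

  VanishesBelow : LSer L → ℤ → Set ℓ
  VanishesBelow s a = ∀ z → z <ℤ a → coefAt L s z ≈ 0#

  data Position (s : LSer L) (z : ℤ) : Set c where
    below : z <ℤ low s → Position s z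
    at    : ∀ k → z ≡ low s +ℤ + k → Position s z

  private
    split : ∀ z l → z ≡ l +ℤ (z -ℤ l)
    split = solve-∀

    shift-back : ∀ l k → (l +ℤ + k) -ℤ l ≡ + k
    shift-back l k = cancel l (+ k)
      where
      cancel : ∀ l k → (l +ℤ k) -ℤ l ≡ k
      cancel = solve-∀

  position : ∀ s z → Position s z
  position s z with z -ℤ low s in eq
  ... | + k = at k (P.trans (split z (low s)) (P.cong (low s +ℤ_) eq))
  ... | -[1+ k ] = below (P.subst₂ _<ℤ_ (P.sym (P.trans (split z (low s)) (P.cong (low s +ℤ_) eq)))
                                         (ℤP.+-identityʳ (low s)) (ℤP.+-monoʳ-< (low s) Z.-<+))

  coefAt-below-low : ∀ s z → z <ℤ low s → coefAt L s z ≈ 0#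
  coefAt-below-low s z z<l with z -ℤ low s in eq
  ... | -[1+ _ ] = refl
  ... | + k = ⊥-elim (ℤP.<⇒≱ z<l (P.subst (low s ≤ℤ_) (P.sym (P.trans (split z (low s)) (P.cong (low s +ℤ_) eq)))
                                             (ℤP.i≤i+j (low s) (+ k))))

  coefAt-low+ : ∀ s k → coefAt L s (low s +ℤ + k) ≡ coef s k
  coefAt-low+ s k with (low s +ℤ + k) -ℤ low s in eq
  ... | + k' = P.cong (coef s) (ℤP.+-injective (P.trans (P.sym eq) (shift-back (low s) k)))
  ... | -[1+ _ ] with () ← P.trans (P.sym eq) (shift-back (low s) k)

  coefAt-≡low+ : ∀ s z k → z ≡ low s +ℤ + k → coefAt L s z ≡ coef s k
  coefAt-≡low+ s z k P.refl = coefAt-low+ s k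

  vanishesBelow-mono : ∀ {s a b} → b ≤ℤ a → VanishesBelow s a → VanishesBelow s b
  vanishesBelow-mono b≤a g z z<b = g z (ℤP.<-≤-trans z<b b≤a)

  coefAt-zeroS : ∀ z → coefAt L (zeroS L) z ≈ 0#
  coefAt-zeroS z with position (zeroS L) z
  ... | below lt = coefAt-below-low _ z lt
  ... | at k P.refl = reflexive (coefAt-low+ (zeroS L) k)

  coefAt-addS : ∀ s u z → coefAt L (addS L s u) z ≈ coefAt L s z + coefAt L u z
  coefAt-addS s u z with position (addS L s u) z
  ... | at k P.refl = reflexive (coefAt-low+ (addS L s u) k)
  ... | below z<l = trans (coefAt-below-low (addS L s u) z z<l) (sym (trans
        (+-cong (coefAt-below-low s z (ℤP.<-≤-trans z<l (ℤP.i⊓j≤i (low s) (low u))))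
                (coefAt-below-low u z (ℤP.<-≤-trans z<l (ℤP.i⊓j≤j (low s) (low u)))))
        (+-identityʳ 0#)))

  coefAt-negS : ∀ s z → coefAt L (negS L s) z ≈ - coefAt L s z
  coefAt-negS s z with position s z
  ... | below z<l = trans (coefAt-below-low (negS L s) z z<l) (trans (sym -0#≈0#) (-‿cong (sym (coefAt-below-low s z z<l))))
  ... | at k P.refl = trans (reflexive (coefAt-low+ (negS L s) k)) (-‿cong (reflexive (P.sym (coefAt-low+ s k))))

  *-zeroˡ-≈ : ∀ {x} y → x ≈ 0# → x * y ≈ 0#
  *-zeroˡ-≈ y x≈0 = trans (*-cong x≈0 refl) (zeroˡ y)

  *-zeroʳ-≈ : ∀ x {y} → y ≈ 0# → x * y ≈ 0#
  *-zeroʳ-≈ x y≈0 = trans (*-cong refl y≈0) (zeroʳ x)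

  sumℕ-cong : ∀ m f g → (∀ j → j < m → f j ≈ g j) → sumℕ L m f ≈ sumℕ L m g
  sumℕ-cong zero f g h = refl
  sumℕ-cong (suc m) f g h =
    +-cong (h 0 ℕ.z<s) (sumℕ-cong m (λ k → f (suc k)) (λ k → g (suc k)) (λ j j<m → h (suc j) (ℕ.s<s j<m)))

  sumℕ-zero : ∀ m f → (∀ j → j < m → f j ≈ 0#) → sumℕ L m f ≈ 0#
  sumℕ-zero zero f h = refl
  sumℕ-zero (suc m) f h =
    trans (+-cong (h 0 ℕ.z<s) (sumℕ-zero m (λ k → f (suc k)) (λ j j<m → h (suc j) (ℕ.s<s j<m)))) (+-identityʳ 0#)

  sumℕ-single : ∀ m f j₀ → j₀ < m → (∀ j → j < m → ¬ (j ≡ j₀) → f j ≈ 0#) → sumℕ L m f ≈ f j₀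
  sumℕ-single (suc m) f zero _ h =
    trans (+-cong refl (sumℕ-zero m (λ k → f (suc k)) (λ j j<m → h (suc j) (ℕ.s<s j<m) (λ ())))) (+-identityʳ _)
  sumℕ-single (suc m) f (suc j₀) (ℕ.s<s j₀<m) h =
    trans (+-cong (h 0 ℕ.z<s (λ ())) (sumℕ-single m (λ k → f (suc k)) j₀ j₀<m
                                        (λ j j<m j≢j₀ → h (suc j) (ℕ.s<s j<m) (λ e → j≢j₀ (ℕP.suc-injective e)))))
          (+-identityˡ _)

  private
    exponent-split : ∀ ls lu j K → j ℕ.≤ K → (ls +ℤ + j) +ℤ (lu +ℤ + (K ℕ.∸ j)) ≡ (ls +ℤ lu) +ℤ + K
    exponent-split ls lu j K j≤K =
      P.trans (by-ring ls lu (+ j) (+ (K ℕ.∸ j)))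
              (P.cong ((ls +ℤ lu) +ℤ_) (P.trans (P.sym (ℤP.pos-+ j (K ℕ.∸ j))) (P.cong +_ (ℕP.m+[n∸m]≡n j≤K))))
      where
      by-ring : ∀ ls lu a b → (ls +ℤ a) +ℤ (lu +ℤ b) ≡ (ls +ℤ lu) +ℤ (a +ℤ b)
      by-ring = solve-∀

  coefAt-mulS-sum : ∀ s u {z} K → z ≡ (low s +ℤ low u) +ℤ + K → coefAt L (mulS L s u) z ≈
    sumℕ L (suc K) (λ j → coefAt L s (low s +ℤ + j) * coefAt L u (low u +ℤ + (K ℕ.∸ j)))
  coefAt-mulS-sum s u K P.refl = trans (reflexive (coefAt-low+ (mulS L s u) K))
    (sumℕ-cong (suc K) _ _ λ j _ → *-cong (reflexive (P.sym (coefAt-low+ s j))) (reflexive (P.sym (coefAt-low+ u (K ℕ.∸ j)))))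

  cauchy-term-vanishes : ∀ {s u a b K} → VanishesBelow s a → VanishesBelow u b → a +ℤ b ≡ (low s +ℤ low u) +ℤ + K →
    ∀ j → j ℕ.≤ K → ¬ (low s +ℤ + j ≡ a) → coefAt L s (low s +ℤ + j) * coefAt L u (low u +ℤ + (K ℕ.∸ j)) ≈ 0#
  cauchy-term-vanishes {s} {u} {a} {b} {K} gs gu eq j j≤K x≢a with ℤP.<-cmp (low s +ℤ + j) a
  ... | tri< x<a _ _ = *-zeroˡ-≈ _ (gs _ x<a)
  ... | tri≈ _ x≡a _ = ⊥-elim (x≢a x≡a)
  ... | tri> _ _ a<x = *-zeroʳ-≈ _ (gu _ (+≡+-<ˡ⇒>ʳ _ _ a b (P.trans (exponent-split (low s) (low u) j K j≤K) (P.sym eq)) a<x))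

  mulS-vanishesBelow : ∀ {s u a b} → VanishesBelow s a → VanishesBelow u b → VanishesBelow (mulS L s u) (a +ℤ b)
  mulS-vanishesBelow {s} {u} {a} {b} gs gu z z<ab with position (mulS L s u) z
  ... | below z<l = coefAt-below-low (mulS L s u) z z<l
  ... | at K z≡ = trans (coefAt-mulS-sum s u K z≡) (sumℕ-zero (suc K) _ term)
    where
    term : ∀ j → j < suc K → coefAt L s (low s +ℤ + j) * coefAt L u (low u +ℤ + (K ℕ.∸ j)) ≈ 0#
    term j (ℕ.s≤s j≤K) with (low s +ℤ + j) ℤP.<? a
    ... | yes x<a = *-zeroˡ-≈ _ (gs _ x<a)
    ... | no x≮a = *-zeroʳ-≈ _ (gu _ (+<+-≤ˡ⇒<ʳ _ _ a b
                     (P.subst (_<ℤ a +ℤ b) (P.trans z≡ (P.sym (exponent-split (low s) (low u) j K j≤K))) z<ab)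
                     (ℤP.≮⇒≥ x≮a)))

  coefAt-mulS : ∀ {s u a b} → VanishesBelow s a → VanishesBelow u b →
                coefAt L (mulS L s u) (a +ℤ b) ≈ coefAt L s a * coefAt L u b
  coefAt-mulS {s} {u} {a} {b} gs gu with position (mulS L s u) (a +ℤ b) | position s a
  ... | below lt | below a<ls =
    trans (coefAt-below-low _ _ lt) (sym (*-zeroˡ-≈ _ (coefAt-below-low s a a<ls)))
  ... | below lt | at j P.refl =
    trans (coefAt-below-low _ _ lt) (sym (*-zeroʳ-≈ _ (coefAt-below-low u b
      (+<+-≤ˡ⇒<ʳ _ b (low s) (low u) lt (ℤP.i≤i+j (low s) (+ j))))))
  ... | at K eq | below a<ls =
    trans (coefAt-mulS-sum s u K eq) (trans (sumℕ-zero (suc K) _ term) (sym (*-zeroˡ-≈ _ (coefAt-below-low s a a<ls))))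
    where
    term : ∀ j → j < suc K → coefAt L s (low s +ℤ + j) * coefAt L u (low u +ℤ + (K ℕ.∸ j)) ≈ 0#
    term j (ℕ.s≤s j≤K) = cauchy-term-vanishes gs gu eq j j≤K
      (λ e → ℤP.<⇒≱ a<ls (P.subst (low s ≤ℤ_) e (ℤP.i≤i+j (low s) (+ j))))
  ... | at K eq | at j₀ P.refl with j₀ ℕ.≤? K
  ...   | yes j₀≤K =
    trans (coefAt-mulS-sum s u K eq)
      (trans (sumℕ-single (suc K) _ j₀ (ℕ.s≤s j₀≤K) term) (*-cong refl (reflexive (P.cong (coefAt L u) second))))
    where
    second : low u +ℤ + (K ℕ.∸ j₀) ≡ b
    second = +-cancelˡ (low s +ℤ + j₀) _ _ (P.trans (exponent-split (low s) (low u) j₀ K j₀≤K) (P.sym eq))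
    term : ∀ j → j < suc K → ¬ (j ≡ j₀) → coefAt L s (low s +ℤ + j) * coefAt L u (low u +ℤ + (K ℕ.∸ j)) ≈ 0#
    term j (ℕ.s≤s j≤K) j≢j₀ = cauchy-term-vanishes gs gu eq j j≤K (λ e → j≢j₀ (ℤP.+-injective (+-cancelˡ (low s) _ _ e)))
  ...   | no j₀≰K =
    trans (coefAt-mulS-sum s u K eq) (trans (sumℕ-zero (suc K) _ term) (sym (*-zeroʳ-≈ _ (coefAt-below-low u b b<lu))))
    where
    term : ∀ j → j < suc K → coefAt L s (low s +ℤ + j) * coefAt L u (low u +ℤ + (K ℕ.∸ j)) ≈ 0#
    term j (ℕ.s≤s j≤K) = cauchy-term-vanishes gs gu eq j j≤K
      (λ e → j₀≰K (P.subst (ℕ._≤ K) (ℤP.+-injective (+-cancelˡ (low s) _ _ e)) j≤K))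
    b<lu : b <ℤ low u
    b<lu = +≡+-<ˡ⇒>ʳ (low s +ℤ + j₀) b (low s +ℤ + K) (low u)
      (P.trans eq (by-ring (low s) (low u) (+ K))) (ℤP.+-monoʳ-< (low s) (Z.+<+ (ℕP.≰⇒> j₀≰K)))
      where
      by-ring : ∀ a b c → (a +ℤ b) +ℤ c ≡ (a +ℤ c) +ℤ b
      by-ring = solve-∀

  private
    spread-exponent : ∀ l k d → (l +ℤ + k) *ℤ + suc d ≡ l *ℤ + suc d +ℤ + (k ℕ.* suc d)
    spread-exponent l k d =
      P.trans (ℤP.*-distribʳ-+ (+ suc d) l (+ k)) (P.cong (l *ℤ + suc d +ℤ_) (P.sym (ℤP.pos-* k (suc d))))

  coefAt-spread : ∀ d s z → coefAt L (spread L d s) (z *ℤ + spreadFactor d) ≈ coefAt L s z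
  coefAt-spread zero s z = reflexive (P.cong (coefAt L s) (ℤP.*-identityʳ z))
  coefAt-spread (suc d) s z with position s z
  ... | below z<l =
    trans (coefAt-below-low (spread L (suc d) s) _ (ℤP.*-monoʳ-<-pos (+ suc d) z<l)) (sym (coefAt-below-low s z z<l))
  ... | at k P.refl =
    trans (reflexive (coefAt-≡low+ (spread L (suc d) s) _ (k ℕ.* suc d) (spread-exponent (low s) k d)))
          (reflexive (picked (k ℕ.* suc d) (m*n%n≡0 k (suc d)) (m*n/n≡m k (suc d))))
    where
    -- Abstracting K % (1+d) and K / (1+d) together makes the coefficient of spread compute.
    picked : ∀ K → K ℕ.% suc d ≡ 0 → K ℕ./ suc d ≡ k → coef (spread L (suc d) s) K ≡ coefAt L s (low s +ℤ + k)
    picked K _ K/d≡k with K ℕ.% suc d | K ℕ./ suc d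
    ... | zero | q = P.trans (P.cong (coef s) K/d≡k) (P.sym (coefAt-low+ s k))

  spread-vanishesBelow : ∀ d s a → VanishesBelow s a → VanishesBelow (spread L d s) (a *ℤ + spreadFactor d)
  spread-vanishesBelow zero s a g z z<a = g z (P.subst (z <ℤ_) (ℤP.*-identityʳ a) z<a)
  spread-vanishesBelow (suc d) s a g z z<a with position (spread L (suc d) s) z
  ... | below z<l = coefAt-below-low _ z z<l
  ... | at K P.refl =
    trans (reflexive (coefAt-low+ (spread L (suc d) s) K)) (picked K (m≡m%n+[m/n]*n K (suc d)) z<a)
    where
    picked : ∀ K → K ≡ K ℕ.% suc d ℕ.+ (K ℕ./ suc d) ℕ.* suc d →
             low s *ℤ + suc d +ℤ + K <ℤ a *ℤ + suc d → coef (spread L (suc d) s) K ≈ 0#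
    picked K K≡ lt with K ℕ.% suc d | K ℕ./ suc d
    ... | suc _ | q = refl
    ... | zero | q = trans (reflexive (P.sym (coefAt-low+ s q))) (g (low s +ℤ + q)
      (ℤP.*-cancelʳ-<-nonNeg {low s +ℤ + q} {a} (+ suc d)
        (P.subst (_<ℤ a *ℤ + suc d) (P.trans (P.cong (λ t → low s *ℤ + suc d +ℤ + t) K≡)
                                             (P.sym (spread-exponent (low s) q d))) lt)))

  spread-nonzero⇒multiple : ∀ d s z → ¬ (coefAt L (spread L d s) z ≈ 0#) → ∃ λ w → z ≡ w *ℤ + spreadFactor d
  spread-nonzero⇒multiple zero s z _ = z , P.sym (ℤP.*-identityʳ z)
  spread-nonzero⇒multiple (suc d) s z nz with position (spread L (suc d) s) z
  ... | below z<l = ⊥-elim (nz (coefAt-below-low _ z z<l))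
  ... | at K P.refl =
    picked K (m≡m%n+[m/n]*n K (suc d)) (λ e → nz (trans (reflexive (coefAt-low+ (spread L (suc d) s) K)) e))
    where
    picked : ∀ K → K ≡ K ℕ.% suc d ℕ.+ (K ℕ./ suc d) ℕ.* suc d → ¬ (coef (spread L (suc d) s) K ≈ 0#) →
             ∃ λ w → low s *ℤ + suc d +ℤ + K ≡ w *ℤ + suc d
    picked K K≡ nz′ with K ℕ.% suc d | K ℕ./ suc d
    ... | suc _ | q = ⊥-elim (nz′ refl)
    ... | zero | q = (low s +ℤ + q) ,
      P.trans (P.cong (λ t → low s *ℤ + suc d +ℤ + t) K≡) (P.sym (spread-exponent (low s) q d))

  coefAt-spread-zeroS : ∀ d z → coefAt L (spread L d (zeroS L)) z ≈ 0#
  coefAt-spread-zeroS zero z = coefAt-zeroS z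
  coefAt-spread-zeroS (suc d) z with position (spread L (suc d) (zeroS L)) z
  ... | below lt = coefAt-below-low _ z lt
  ... | at K P.refl = trans (reflexive (coefAt-low+ (spread L (suc d) (zeroS L)) K)) (picked K)
    where
    picked : ∀ K → coef (spread L (suc d) (zeroS L)) K ≈ 0#
    picked K with K ℕ.% suc d
    ... | zero = refl
    ... | suc _ = refl

  -- Gauss's lemma for the weighted order of a product of linear factors

  -- lineAt s w j is the exponent z for which t^z Y^j has order w when Y is given weight s.
  lineAt : ℤ → ℤ → ℕ → ℤ
  lineAt s w j = w -ℤ s *ℤ + j

  private
    lineAt-zero : ∀ s w → lineAt s w 0 ≡ w
    lineAt-zero s w = by-ring s w
      where
      by-ring : ∀ s w → w -ℤ s *ℤ + 0 ≡ w
      by-ring = solve-∀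

    lineAt-suc : ∀ s w j → lineAt s w j ≡ lineAt s w (suc j) +ℤ s
    lineAt-suc s w j = P.trans (by-ring s w (+ j)) (P.cong (λ t → (w -ℤ s *ℤ t) +ℤ s) (P.sym (ℤP.pos-+ 1 j)))
      where
      by-ring : ∀ s w j → w -ℤ s *ℤ j ≡ (w -ℤ s *ℤ (+ 1 +ℤ j)) +ℤ s
      by-ring = solve-∀

    lineAt-+ : ∀ a s w j → lineAt s (a +ℤ w) j ≡ a +ℤ lineAt s w j
    lineAt-+ a s w j = by-ring a s w (+ j)
      where
      by-ring : ∀ a s w j → (a +ℤ w) -ℤ s *ℤ j ≡ a +ℤ (w -ℤ s *ℤ j)
      by-ring = solve-∀

    lineAt-s+-suc : ∀ s w j → lineAt s (s +ℤ w) (suc j) ≡ lineAt s w j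
    lineAt-s+-suc s w j = P.trans (lineAt-+ s s w (suc j)) (P.trans (ℤP.+-comm s _) (P.sym (lineAt-suc s w j)))

    minus-vanishing : ∀ {a a′ b} → a ≈ a′ → b ≈ 0# → a + - b ≈ a′
    minus-vanishing a≈a′ b≈0 = trans (+-cong a≈a′ (trans (-‿cong b≈0) -0#≈0#)) (+-identityʳ _)

  -- The largest index attaining the order is recorded: multiplying by Y − c then cannot cancel its coefficient.
  record WeightedOrder (s : ℤ) (Q : ℕ → LSer L) (w : ℤ) : Set (c ⊔ ℓ) where
    field
      bound          : ∀ j → VanishesBelow (Q j) (lineAt s w j)
      top            : ℕ
      leading        : Carrier
      leading≉0      : ¬ (leading ≈ 0#)
      leading-at-top : coefAt L (Q top) (lineAt s w top) ≈ leading
      above-top      : ∀ j → top < j → coefAt L (Q j) (lineAt s w j) ≈ 0#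

  NoZeroDivisors : Set (c ⊔ ℓ)
  NoZeroDivisors = ∀ {x y} → ¬ (x ≈ 0#) → ¬ (y ≈ 0#) → ¬ (x * y ≈ 0#)

  field⇒noZeroDivisors : IsField L → NoZeroDivisors
  field⇒noZeroDivisors (_ , inverse) {x} {y} x≉0 y≉0 xy≈0 with inverse x x≉0
  ... | x⁻¹ , xx⁻¹≈1 = y≉0 (begin
    y               ≈⟨ sym (*-identityˡ y) ⟩
    1# * y          ≈⟨ *-cong (sym (trans (*-comm x⁻¹ x) xx⁻¹≈1)) refl ⟩
    (x⁻¹ * x) * y   ≈⟨ *-assoc x⁻¹ x y ⟩
    x⁻¹ * (x * y)   ≈⟨ *-zeroʳ-≈ x⁻¹ xy≈0 ⟩
    0#              ∎)
    where open import Relation.Binary.Reasoning.Setoid setoid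

  coefAt-Y* : (ℕ → LSer L) → ℕ → ℤ → Carrier
  coefAt-Y* Q zero z = 0#
  coefAt-Y* Q (suc j) z = coefAt L (Q j) z

  coefAt-prodLin-suc : ∀ {m} (ys : Fin (suc m) → LSer L) j z →
    coefAt L (prodLin L ys j) z ≈
      coefAt-Y* (prodLin L (λ i → ys (fsuc i))) j z + - coefAt L (mulS L (ys fzero) (prodLin L (λ i → ys (fsuc i)) j)) z
  coefAt-prodLin-suc ys zero z = trans (coefAt-negS _ z) (sym (+-identityˡ _))
  coefAt-prodLin-suc ys (suc j) z = trans (coefAt-addS _ _ z) (+-cong refl (coefAt-negS _ z))

  module _ {s W : ℤ} {c : LSer L} {Q Q′ : ℕ → LSer L} (R : WeightedOrder s Q W)
           (Q′≈ : ∀ j z → coefAt L (Q′ j) z ≈ coefAt-Y* Q j z + - coefAt L (mulS L c (Q j)) z) where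
    open WeightedOrder R

    weightedOrder-Y-minus-≥ : VanishesBelow c s → WeightedOrder s Q′ (s +ℤ W)
    weightedOrder-Y-minus-≥ gc = record
      { bound = bound′ ; top = suc top ; leading = leading ; leading≉0 = leading≉0
      ; leading-at-top = trans (Q′≈ (suc top) (lineAt s (s +ℤ W) (suc top)))
          (minus-vanishing (Y*-on-line top leading-at-top) (cQ-on-line (suc top) (above-top (suc top) ℕP.≤-refl)))
      ; above-top = above-top′ }
      where
      cQ-on-line : ∀ j → coefAt L (Q j) (lineAt s W j) ≈ 0# → coefAt L (mulS L c (Q j)) (lineAt s (s +ℤ W) j) ≈ 0#
      cQ-on-line j Qj≈0 = trans (reflexive (P.cong (coefAt L (mulS L c (Q j))) (lineAt-+ s s W j)))
                                (trans (coefAt-mulS gc (bound j)) (*-zeroʳ-≈ _ Qj≈0))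
      Y*-on-line : ∀ j {x} → coefAt L (Q j) (lineAt s W j) ≈ x → coefAt-Y* Q (suc j) (lineAt s (s +ℤ W) (suc j)) ≈ x
      Y*-on-line j = trans (reflexive (P.cong (coefAt L (Q j)) (lineAt-s+-suc s W j)))
      Y*-bound : ∀ j z → z <ℤ lineAt s (s +ℤ W) j → coefAt-Y* Q j z ≈ 0#
      Y*-bound zero z _ = refl
      Y*-bound (suc j) z lt = bound j z (P.subst (z <ℤ_) (lineAt-s+-suc s W j) lt)
      bound′ : ∀ j → VanishesBelow (Q′ j) (lineAt s (s +ℤ W) j)
      bound′ j z lt = trans (Q′≈ j z) (minus-vanishing (Y*-bound j z lt)
        (mulS-vanishesBelow gc (bound j) z (P.subst (z <ℤ_) (lineAt-+ s s W j) lt)))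
      above-top′ : ∀ j → suc top < j → coefAt L (Q′ j) (lineAt s (s +ℤ W) j) ≈ 0#
      above-top′ (suc j) (ℕ.s<s top<j) = trans (Q′≈ (suc j) (lineAt s (s +ℤ W) (suc j)))
        (minus-vanishing (Y*-on-line j (above-top j top<j)) (cQ-on-line (suc j) (above-top (suc j) (ℕP.m<n⇒m<1+n top<j))))

    weightedOrder-Y-minus-< : NoZeroDivisors →
      ∀ v → v <ℤ s → VanishesBelow c v → ¬ (coefAt L c v ≈ 0#) → WeightedOrder s Q′ (v +ℤ W)
    weightedOrder-Y-minus-< nonzero-* v v<s gc cᵥ≉0 = record
      { bound = bound′ ; top = top ; leading = - (coefAt L c v * leading)
      ; leading≉0 = λ e → nonzero-* cᵥ≉0 leading≉0 (trans (sym (-‿involutive _)) (trans (-‿cong e) -0#≈0#))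
      ; leading-at-top = trans (Q′≈ top (lineAt s (v +ℤ W) top)) (trans (+-cong (Y*-vanishes top _ ℤP.≤-refl) (-‿cong (cQ-on-line top leading-at-top)))
                                                  (+-identityˡ _))
      ; above-top = λ j top<j → trans (Q′≈ j (lineAt s (v +ℤ W) j)) (minus-vanishing (Y*-vanishes j _ ℤP.≤-refl)
                                   (trans (cQ-on-line j (above-top j top<j)) (*-zeroʳ-≈ _ refl))) }
      where
      cQ-on-line : ∀ j {x} → coefAt L (Q j) (lineAt s W j) ≈ x →
                   coefAt L (mulS L c (Q j)) (lineAt s (v +ℤ W) j) ≈ coefAt L c v * x
      cQ-on-line j Qj≈x = trans (reflexive (P.cong (coefAt L (mulS L c (Q j))) (lineAt-+ v s W j)))
                                (trans (coefAt-mulS gc (bound j)) (*-cong refl Qj≈x))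
      -- Since v < s, the line of order v + W passes strictly below the support of Y·Q.
      Y*-vanishes : ∀ j z → z ≤ℤ lineAt s (v +ℤ W) j → coefAt-Y* Q j z ≈ 0#
      Y*-vanishes zero z _ = refl
      Y*-vanishes (suc j) z le = bound j z (ℤP.≤-<-trans (P.subst (z ≤ℤ_) (lineAt-+ v s W (suc j)) le)
        (P.subst₂ _<ℤ_ (ℤP.+-comm _ v) (P.sym (lineAt-suc s W j)) (ℤP.+-monoʳ-< (lineAt s W (suc j)) v<s)))
      bound′ : ∀ j → VanishesBelow (Q′ j) (lineAt s (v +ℤ W) j)
      bound′ j z lt = trans (Q′≈ j z) (minus-vanishing (Y*-vanishes j z (ℤP.<⇒≤ lt))
        (mulS-vanishesBelow gc (bound j) z (P.subst (z <ℤ_) (lineAt-+ v s W j) lt)))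

  data Valuation (x : LSer L) : Set (c ⊔ ℓ) where
    ∞      : (∀ z → coefAt L x z ≈ 0#) → Valuation x
    finite : ∀ v → VanishesBelow x v → ¬ (coefAt L x v ≈ 0#) → Valuation x

  min-valuation : ℤ → ∀ {x} → Valuation x → ℤ
  min-valuation s (∞ _) = s
  min-valuation s (finite v _ _) = s ⊓ℤ v

  sum-min-valuation : ℤ → ∀ {m} {ys : Fin m → LSer L} → (∀ i → Valuation (ys i)) → ℤ
  sum-min-valuation s ds = sum (λ i → min-valuation s (ds i))

  module _ (nonzero-* : NoZeroDivisors) {s W : ℤ} {c : LSer L} {Q Q′ : ℕ → LSer L} (R : WeightedOrder s Q W)
           (Q′≈ : ∀ j z → coefAt L (Q′ j) z ≈ coefAt-Y* Q j z + - coefAt L (mulS L c (Q j)) z) where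

    weightedOrder-Y-minus : (d : Valuation c) → WeightedOrder s Q′ (min-valuation s d +ℤ W)
    weightedOrder-Y-minus (∞ c≈0) = weightedOrder-Y-minus-≥ R Q′≈ (λ z _ → c≈0 z)
    weightedOrder-Y-minus (finite v gc cᵥ≉0) with s ℤP.≤? v
    ... | yes s≤v = P.subst (λ w → WeightedOrder s Q′ (w +ℤ W)) (P.sym (ℤP.i≤j⇒i⊓j≡i s≤v))
                      (weightedOrder-Y-minus-≥ R Q′≈ (vanishesBelow-mono s≤v gc))
    ... | no s≰v = P.subst (λ w → WeightedOrder s Q′ (w +ℤ W)) (P.sym (ℤP.i≥j⇒i⊓j≡j (ℤP.<⇒≤ v<s)))
                      (weightedOrder-Y-minus-< R Q′≈ nonzero-* v v<s gc cᵥ≉0)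
      where v<s = ℤP.≰⇒> s≰v

  weightedOrder-prodLin : ¬ (1# ≈ 0#) → NoZeroDivisors → ∀ s {m} (ys : Fin m → LSer L) (ds : ∀ i → Valuation (ys i)) →
                          WeightedOrder s (prodLin L ys) (sum-min-valuation s ds)
  weightedOrder-prodLin 1≉0 nonzero-* s {zero} ys ds = record
    { bound = bound ; top = 0 ; leading = 1# ; leading≉0 = 1≉0
    ; leading-at-top = trans (reflexive (P.cong (coefAt L (oneS L)) (lineAt-zero s (+ 0)))) (reflexive (coefAt-low+ (oneS L) 0))
    ; above-top = λ { (suc j) _ → coefAt-zeroS (lineAt s (+ 0) (suc j)) } }
    where
    bound : ∀ j → VanishesBelow (prodLin L ys j) (lineAt s (+ 0) j)
    bound zero z lt = coefAt-below-low (oneS L) z (P.subst (z <ℤ_) (lineAt-zero s (+ 0)) lt)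
    bound (suc j) z _ = coefAt-zeroS z
  weightedOrder-prodLin 1≉0 nonzero-* s {suc m} ys ds =
    weightedOrder-Y-minus nonzero-* (weightedOrder-prodLin 1≉0 nonzero-* s (λ i → ys (fsuc i)) (λ i → ds (fsuc i)))
                          (coefAt-prodLin-suc ys) (ds fzero)

  valuation-spread-rootSer : ∀ d κ a → (∀ k → κ ≡ just k → ¬ (a 0 ≈ 0#)) → Valuation (spread L d (rootSer L κ a))
  valuation-spread-rootSer d nothing a _ = ∞ (coefAt-spread-zeroS d)
  valuation-spread-rootSer d (just k) a a₀≉0 = finite (k *ℤ + spreadFactor d)
    (spread-vanishesBelow d (lser k a) k (coefAt-below-low (lser k a)))
    (λ e → a₀≉0 k P.refl (trans (sym (reflexive (coefAt-≡low+ (lser k a) k 0 (P.sym (ℤP.+-identityʳ k)))))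
                               (trans (sym (coefAt-spread d (lser k a) k)) e)))

  min-valuation-spread-rootSer : ∀ s d κ a a₀≉0 →
    min-valuation s (valuation-spread-rootSer d κ a a₀≉0) ≡ minScaled s (spreadFactor d) κ
  min-valuation-spread-rootSer s d nothing a _ = P.refl
  min-valuation-spread-rootSer s d (just k) a _ = P.refl

  weightedOrder-cong : ∀ {s w Q Q′} → (∀ j z → coefAt L (Q′ j) z ≈ coefAt L (Q j) z) →
                       WeightedOrder s Q w → WeightedOrder s Q′ w
  weightedOrder-cong {s} {w} Q′≈Q R = record
    { bound = λ j z lt → trans (Q′≈Q j z) (bound j z lt) ; top = top ; leading = leading ; leading≉0 = leading≉0
    ; leading-at-top = trans (Q′≈Q top (lineAt s w top)) leading-at-top
    ; above-top = λ j top<j → trans (Q′≈Q j (lineAt s w j)) (above-top j top<j) }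
    where open WeightedOrder R

  weightedOrder-mulS : NoZeroDivisors → ∀ {s W f Q} v → VanishesBelow f v → ¬ (coefAt L f v ≈ 0#) →
                       WeightedOrder s Q W → WeightedOrder s (λ j → mulS L f (Q j)) (v +ℤ W)
  weightedOrder-mulS nonzero-* {s} {W} {f} {Q} v gf fᵥ≉0 R = record
    { bound = λ j z lt → mulS-vanishesBelow gf (bound j) z (P.subst (z <ℤ_) (lineAt-+ v s W j) lt)
    ; top = top ; leading = coefAt L f v * leading ; leading≉0 = nonzero-* fᵥ≉0 leading≉0
    ; leading-at-top = fQ-on-line top leading-at-top
    ; above-top = λ j top<j → trans (fQ-on-line j (above-top j top<j)) (zeroʳ _) }
    where
    open WeightedOrder R
    fQ-on-line : ∀ j {x} → coefAt L (Q j) (lineAt s W j) ≈ x → coefAt L (mulS L f (Q j)) (lineAt s (v +ℤ W) j) ≈ coefAt L f v * x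
    fQ-on-line j Qj≈x = trans (reflexive (P.cong (coefAt L (mulS L f (Q j))) (lineAt-+ v s W j)))
                              (trans (coefAt-mulS gf (bound j)) (*-cong refl Qj≈x))

-- The summands as fractions with a common denominator

/-cross : ∀ a b d₁ d₂ → a *ℤ + suc d₂ ≡ b *ℤ + suc d₁ → a / suc d₁ ≡ b / suc d₂
/-cross a b d₁ d₂ eq = ℚP.fromℚᵘ-cong {ℚᵘ.mkℚᵘ a d₁} {ℚᵘ.mkℚᵘ b d₂} (ℚᵘ.*≡* eq)

/-cross-≤ : ∀ a b d₁ d₂ → a *ℤ + suc d₂ ≤ℤ b *ℤ + suc d₁ → a / suc d₁ ℚ.≤ b / suc d₂
/-cross-≤ a b d₁ d₂ le = ℚP.toℚᵘ-cancel-≤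
  (ℚᵘP.≤-respˡ-≃ (ℚᵘP.≃-sym (ℚP.toℚᵘ-fromℚᵘ (ℚᵘ.mkℚᵘ a d₁)))
    (ℚᵘP.≤-respʳ-≃ (ℚᵘP.≃-sym (ℚP.toℚᵘ-fromℚᵘ (ℚᵘ.mkℚᵘ b d₂))) (ℚᵘ.*≤* le)))

/-+ : ∀ a b d → (a / suc d) ℚ.+ (b / suc d) ≡ (a +ℤ b) / suc d
/-+ a b d = ℚP.toℚᵘ-injective (ℚᵘP.≃-trans (ℚP.toℚᵘ-homo-+ (a / suc d) (b / suc d))
  (ℚᵘP.≃-trans (ℚᵘP.+-cong (ℚP.toℚᵘ-fromℚᵘ (ℚᵘ.mkℚᵘ a d)) (ℚP.toℚᵘ-fromℚᵘ (ℚᵘ.mkℚᵘ b d)))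
  (ℚᵘP.≃-trans (ℚᵘ.*≡* (P.trans (by-ring a b (+ suc d)) (P.cong ((a +ℤ b) *ℤ_) (P.sym (ℤP.pos-* (suc d) (suc d))))))
               (ℚᵘP.≃-sym (ℚP.toℚᵘ-fromℚᵘ (ℚᵘ.mkℚᵘ (a +ℤ b) d))))))
  where
  by-ring : ∀ a b D → (a *ℤ D +ℤ b *ℤ D) *ℤ D ≡ (a +ℤ b) *ℤ (D *ℤ D)
  by-ring = solve-∀

sumFinℚ-/ : ∀ {m} (f : Fin m → ℚ) (G : Fin m → ℤ) d → (∀ i → f i ≡ G i / suc d) → sumFinℚ f ≡ sum G / suc d
sumFinℚ-/ {zero} f G d _ = /-cross (+ 0) (+ 0) 0 d P.refl
sumFinℚ-/ {suc m} f G d f≡ =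
  P.trans (P.cong₂ ℚ._+_ (f≡ fzero) (sumFinℚ-/ (λ i → f (fsuc i)) (λ i → G (fsuc i)) d (λ i → f≡ (fsuc i))))
          (/-+ (G fzero) (sum (λ i → G (fsuc i))) d)

sum-minus : ∀ {m} (A B : Fin m → ℤ) → sum (λ i → A i -ℤ B i) ≡ sum A -ℤ sum B
sum-minus {zero} A B = P.refl
sum-minus {suc m} A B = P.trans (P.cong ((A fzero -ℤ B fzero) +ℤ_) (sum-minus (λ i → A (fsuc i)) (λ i → B (fsuc i))))
                                (by-ring (A fzero) (B fzero) (sum (λ i → A (fsuc i))) (sum (λ i → B (fsuc i))))
  where
  by-ring : ∀ a b x y → (a -ℤ b) +ℤ (x -ℤ y) ≡ (a +ℤ x) -ℤ (b +ℤ y)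
  by-ring = solve-∀

∣prodFinℕ : ∀ {m} (f : Fin m → ℕ) i → f i ∣ prodFinℕ f
∣prodFinℕ f fzero = m∣m*n _
∣prodFinℕ f (fsuc i) = ∣-trans (∣prodFinℕ (λ j → f (fsuc j)) i) (n∣m*n (f fzero))

prodFinℕ-positive : ∀ {m} (f : Fin m → ℕ) → (∀ i → 1 ℕ.≤ f i) → 1 ℕ.≤ prodFinℕ f
prodFinℕ-positive {zero} f _ = ℕ.s≤s ℕ.z≤n
prodFinℕ-positive {suc m} f f≥1 = ℕP.*-mono-≤ (f≥1 fzero) (prodFinℕ-positive (λ j → f (fsuc j)) (λ j → f≥1 (fsuc j)))

≡*spreadFactor-quot : ∀ e E d → E ≡ suc d → e ∣ E → suc d ≡ e ℕ.* spreadFactor (quot E e)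
≡*spreadFactor-quot zero E d E≡ (divides k E≡k*0) with () ← P.trans (P.sym E≡) (P.trans E≡k*0 (ℕP.*-zeroʳ k))
≡*spreadFactor-quot (suc e) E d E≡ (divides zero E≡0) with () ← P.trans (P.sym E≡) E≡0
≡*spreadFactor-quot (suc e) E d E≡ (divides (suc k) E≡k*e) =
  P.trans (P.sym E≡) (P.trans E≡k*e (P.trans (ℕP.*-comm (suc k) (suc e)) (P.cong (λ q → suc e ℕ.* spreadFactor q) (P.sym quot≡k))))
  where
  quot≡k : quot E (suc e) ≡ suc k
  quot≡k = P.trans (P.cong (ℕ._/ suc e) E≡k*e) (m*n/n≡m (suc k) (suc e))

private
  pos-*-≡ : ∀ a b c d → a ℕ.* b ≡ c ℕ.* d → + a *ℤ + b ≡ + c *ℤ + d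
  pos-*-≡ a b c d e = P.trans (P.sym (ℤP.pos-* a b)) (P.trans (P.cong +_ e) (ℤP.pos-* c d))

  pos-*-≤ : ∀ a b c d → a ℕ.* b ℕ.≤ c ℕ.* d → + a *ℤ + b ≤ℤ + c *ℤ + d
  pos-*-≤ a b c d e = P.subst₂ _≤ℤ_ (ℤP.pos-* a b) (ℤP.pos-* c d) (Z.+≤+ e)

  1≡D/D : ∀ d → 1ℚ ≡ (+ suc d -ℤ + 0) / suc d
  1≡D/D d = /-cross (+ 1) (+ suc d -ℤ + 0) 0 d (by-ring (+ suc d))
    where
    by-ring : ∀ D → + 1 *ℤ D ≡ (D -ℤ + 0) *ℤ + 1
    by-ring = solve-∀

-- With D = e·q, the summand min{1, k/e} (k > 0) becomes (min(D, k·q) − min(0, k·q)) / D.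
contribution-as-fraction : ∀ e q d → suc d ≡ e ℕ.* q → ∀ κ →
  contribution e κ ≡ (minScaled (+ suc d) q κ -ℤ minScaled (+ 0) q κ) / suc d
contribution-as-fraction zero q d () κ
contribution-as-fraction (suc e) zero d D≡ κ with () ← P.trans D≡ (ℕP.*-zeroʳ e)
contribution-as-fraction (suc e) (suc q) d D≡ nothing = 1≡D/D d
contribution-as-fraction (suc e) (suc q) d D≡ (just (+ zero)) =
  /-cross (+ 0) (minScaled (+ suc d) (suc q) (just (+ 0)) -ℤ minScaled (+ 0) (suc q) (just (+ 0))) 0 d P.refl
contribution-as-fraction (suc e) (suc q) d D≡ (just -[1+ k ]) =
  P.trans (/-cross (+ 0) (+ 0) 0 d P.refl) (P.cong (_/ suc d) (P.sym numerator≡0))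
  where
  v = -[1+ k ] *ℤ + suc q
  numerator≡0 : (+ suc d ⊓ℤ v) -ℤ (+ 0 ⊓ℤ v) ≡ + 0
  numerator≡0 = P.trans (P.cong₂ _-ℤ_ (ℤP.i≥j⇒i⊓j≡j {+ suc d} {v} Z.-≤+) (ℤP.i≥j⇒i⊓j≡j {+ 0} {v} Z.-≤+)) (ℤP.+-inverseʳ v)
contribution-as-fraction (suc e) (suc q) d D≡ (just (+ suc k)) with suc k ℕ.≤? suc e
... | yes k≤e =
  P.trans (ℚP.p≥q⇒p⊓q≡q (/-cross-≤ (+ suc k) (+ 1) e 0 (pos-*-≤ (suc k) 1 1 (suc e)
            (P.subst₂ ℕ._≤_ (P.sym (ℕP.*-identityʳ (suc k))) (P.sym (ℕP.*-identityˡ (suc e))) k≤e))))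
  (P.trans (/-cross (+ suc k) (+ kq) e d (pos-*-≡ (suc k) (suc d) kq (suc e) kD≡kq·e))
           (P.cong (_/ suc d) (P.sym numerator≡kq)))
  where
  kq = suc k ℕ.* suc q
  kD≡kq·e : suc k ℕ.* suc d ≡ kq ℕ.* suc e
  kD≡kq·e = P.trans (P.cong (suc k ℕ.*_) (P.trans D≡ (ℕP.*-comm (suc e) (suc q)))) (P.sym (ℕP.*-assoc (suc k) (suc q) (suc e)))
  kq≤D : kq ℕ.≤ suc d
  kq≤D = P.subst (kq ℕ.≤_) (P.sym D≡) (ℕP.*-monoˡ-≤ (suc q) k≤e)
  numerator≡kq : (+ suc d ⊓ℤ (+ suc k *ℤ + suc q)) -ℤ (+ 0 ⊓ℤ (+ suc k *ℤ + suc q)) ≡ + kq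
  numerator≡kq = P.trans (P.cong (λ x → (+ suc d ⊓ℤ x) -ℤ (+ 0 ⊓ℤ x)) (P.sym (ℤP.pos-* (suc k) (suc q))))
    (P.trans (P.cong₂ _-ℤ_ (ℤP.i≥j⇒i⊓j≡j (Z.+≤+ kq≤D)) (ℤP.i≤j⇒i⊓j≡i {+ 0} {+ kq} (Z.+≤+ ℕ.z≤n))) (ℤP.+-identityʳ (+ kq)))
... | no k≰e =
  P.trans (ℚP.p≤q⇒p⊓q≡p (/-cross-≤ (+ 1) (+ suc k) 0 e (pos-*-≤ 1 (suc e) (suc k) 1
            (P.subst₂ ℕ._≤_ (P.sym (ℕP.*-identityˡ (suc e))) (P.sym (ℕP.*-identityʳ (suc k))) (ℕP.<⇒≤ (ℕP.≰⇒> k≰e))))))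
  (P.trans (1≡D/D d) (P.cong (λ t → (t -ℤ + 0) / suc d) (P.sym D⊓kq≡D)))
  where
  D≤kq : suc d ℕ.≤ suc k ℕ.* suc q
  D≤kq = P.subst (ℕ._≤ suc k ℕ.* suc q) (P.sym D≡) (ℕP.*-monoˡ-≤ (suc q) (ℕP.<⇒≤ (ℕP.≰⇒> k≰e)))
  D⊓kq≡D : + suc d ⊓ℤ (+ suc k *ℤ + suc q) ≡ + suc d
  D⊓kq≡D = P.trans (P.cong (+ suc d ⊓ℤ_) (P.sym (ℤP.pos-* (suc k) (suc q)))) (ℤP.i≤j⇒i⊓j≡i (Z.+≤+ D≤kq))

-- Weights of the support, and partial derivatives at the origin in characteristic 0

module Support {c ℓ} (K : CommutativeRing c ℓ) where
  open CommutativeRing K using (_≈_; 0#)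

  HasMinimalWeight : ℕ → Coeffs2 K → ℕ → Set ℓ
  HasMinimalWeight ω F m =
    (∃₂ λ i j → i ℕ.+ ω ℕ.* j ≡ m × ¬ (F i j ≈ 0#)) × (∀ i j → ¬ (F i j ≈ 0#) → m ℕ.≤ i ℕ.+ ω ℕ.* j)

  minimalWeight-zero : ∀ F j₀ → ¬ (F 0 j₀ ≈ 0#) → HasMinimalWeight 0 F 0
  minimalWeight-zero F j₀ F₀≉0 = (0 , j₀ , P.refl , F₀≉0) , λ _ _ _ → ℕ.z≤n

module CharacteristicZeroField {c ℓ} (K : CommutativeRing c ℓ) (fieldK : IsField K) (char0 : CharacteristicZero K) where
  open CommutativeRing K
  open Support K

  ·-≈-* : ∀ n x → _·_ K n x ≈ _·_ K n 1# * x
  ·-≈-* zero x = sym (zeroˡ x)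
  ·-≈-* (suc n) x = trans (+-cong (sym (*-identityˡ x)) (·-≈-* n x)) (sym (distribʳ x 1# (_·_ K n 1#)))

  ·-vanishes : ∀ n {x} → x ≈ 0# → _·_ K n x ≈ 0#
  ·-vanishes zero x≈0 = refl
  ·-vanishes (suc n) x≈0 = trans (+-cong x≈0 (·-vanishes n x≈0)) (+-identityʳ 0#)

  ·-cancel : ∀ m {x} → _·_ K (suc m) x ≈ 0# → x ≈ 0#
  ·-cancel m {x} mx≈0 with proj₂ fieldK (_·_ K (suc m) 1#) (char0 m)
  ... | y , m1*y≈1 = begin
    x                          ≈⟨ sym (*-identityˡ x) ⟩
    1# * x                     ≈⟨ *-cong (sym (trans (*-comm _ _) m1*y≈1)) refl ⟩
    (y * _·_ K (suc m) 1#) * x ≈⟨ *-assoc _ _ _ ⟩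
    y * (_·_ K (suc m) 1# * x) ≈⟨ *-cong refl (trans (sym (·-≈-* (suc m) x)) mx≈0) ⟩
    y * 0#                     ≈⟨ zeroʳ y ⟩
    0#                         ∎
    where open import Relation.Binary.Reasoning.Setoid setoid

  iter-∂X-transpose : ∀ i G a b → iter i (∂X K) G a b ≡ iter i (∂Y K) (λ x y → G y x) b a
  iter-∂X-transpose zero G a b = P.refl
  iter-∂X-transpose (suc i) G a b = P.cong (_·_ K (suc a)) (iter-∂X-transpose i G (suc a) b)

  iter-∂Y-vanishes⇔ : ∀ j G a b → iter j (∂Y K) G a b ≈ 0# ⇔ G a (b ℕ.+ j) ≈ 0#
  iter-∂Y-vanishes⇔ zero G a b = mk⇔ (vanishes-at (P.sym (ℕP.+-identityʳ b))) (vanishes-at (ℕP.+-identityʳ b))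
    where vanishes-at = P.subst (λ t → G a t ≈ 0#)
  iter-∂Y-vanishes⇔ (suc j) G a b = mk⇔
    (λ e → vanishes-at (P.sym (ℕP.+-suc b j)) (Equivalence.to (iter-∂Y-vanishes⇔ j G a (suc b)) (·-cancel b e)))
    (λ e → ·-vanishes (suc b) (Equivalence.from (iter-∂Y-vanishes⇔ j G a (suc b)) (vanishes-at (ℕP.+-suc b j) e)))
    where vanishes-at = P.subst (λ t → G a t ≈ 0#)

  derivAt00-vanishes⇔ : ∀ i j F → derivAt00 K i j F ≈ 0# ⇔ F i j ≈ 0#
  derivAt00-vanishes⇔ i j F rewrite iter-∂X-transpose i (iter j (∂Y K) F) 0 0 =
    iter-∂Y-vanishes⇔ j F i 0 ⇔-∘ iter-∂Y-vanishes⇔ i (λ x y → iter j (∂Y K) F y x) 0 0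

  order⇒minimalWeight : ∀ F r → IsOrderAtOrigin K F r → HasMinimalWeight 1 F r
  order⇒minimalWeight F r ((i , j , i+j≡r , ∂≉0) , least) =
    (i , j , P.trans (P.cong (i ℕ.+_) (ℕP.*-identityˡ j)) i+j≡r , ∂≉0 ∘ Equivalence.from (derivAt00-vanishes⇔ i j F)) ,
    λ i j Fᵢⱼ≉0 → P.subst (r ℕ.≤_) (P.cong (i ℕ.+_) (P.sym (ℕP.*-identityˡ j)))
                    (least i j (Fᵢⱼ≉0 ∘ Equivalence.to (derivAt00-vanishes⇔ i j F)))

-- The order at the origin read off the Puiseux factorization

module Puiseux {c₁ ℓ₁ c₂ ℓ₂} (K : CommutativeRing c₁ ℓ₁) (L : CommutativeRing c₂ ℓ₂)
  (fieldK : IsField K) (char0 : CharacteristicZero K)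
  (φ : CommutativeRing.Carrier K → CommutativeRing.Carrier L) (extension : IsFiniteFieldExtension K L φ)
  (n : ℕ) (F : Coeffs2 K) (e : Fin n → ℕ) (κ : Fin n → Maybe ℤ) (a : Fin n → ℕ → CommutativeRing.Carrier L)
  (factorization : IsPuiseuxFactorization K L φ n F e κ a) where

  private
    module K = CommutativeRing K
    module L = CommutativeRing L
  open Series L
  open Support K
  open RingMorphisms.IsRingHomomorphism (proj₁ (proj₂ extension))

  nonzero-* : NoZeroDivisors
  nonzero-* = field⇒noZeroDivisors (proj₁ extension)

  φ-≈0 : ∀ {x} → x K.≈ K.0# → φ x L.≈ L.0#
  φ-≈0 x≈0 = L.trans (⟦⟧-cong x≈0) 0#-homo

  φ-≉0 : ∀ {x} → ¬ (x K.≈ K.0#) → ¬ (φ x L.≈ L.0#)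
  φ-≉0 {x} x≉0 φx≈0 with proj₂ fieldK x x≉0
  ... | y , xy≈1 = proj₁ (proj₁ extension)
    (L.trans (L.sym 1#-homo) (L.trans (⟦⟧-cong (K.sym xy≈1)) (L.trans (*-homo x y) (*-zeroˡ-≈ (φ y) φx≈0))))

  E : ℕ
  E = prodFinℕ e

  M : ℕ
  M = spreadFactor E

  roots : Fin n → LSer L
  roots i = spread L (quot E (e i)) (rootSer L (κ i) (a i))

  root-valuation : ∀ i → Valuation (roots i)
  root-valuation i = valuation-spread-rootSer (quot E (e i)) (κ i) (a i) (proj₁ (proj₂ factorization) i)

  Fₓ : ℕ → LSer L
  Fₓ j = lser (+ 0) (λ k → φ (F k j))

  -- F(x, Y) with x = t^M, as a polynomial in Y over L((t))
  Fₜ : ℕ → LSer L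
  Fₜ j = spread L E (Fₓ j)

  coefAt-Fₜ : ∀ i j → coefAt L (Fₜ j) (+ i *ℤ + M) L.≈ φ (F i j)
  coefAt-Fₜ i j = L.trans (coefAt-spread E (Fₓ j) (+ i)) (L.reflexive (coefAt-low+ (Fₓ j) i))

  Fₜ-nonzero⇒ : ∀ j z → ¬ (coefAt L (Fₜ j) z L.≈ L.0#) → ∃ λ i → z ≡ + i *ℤ + M × ¬ (F i j K.≈ K.0#)
  Fₜ-nonzero⇒ j z nz with spread-nonzero⇒multiple E (Fₓ j) z nz
  ... | + i , P.refl = i , P.refl , λ Fᵢⱼ≈0 → nz (L.trans (coefAt-Fₜ i j) (φ-≈0 Fᵢⱼ≈0))
  ... | -[1+ k ] , P.refl = ⊥-elim (nz (L.trans (coefAt-spread E (Fₓ j) -[1+ k ]) (coefAt-below-low (Fₓ j) -[1+ k ] Z.-<+)))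

  weightedOrder-Fₜ : ∀ k₀ → ¬ (F k₀ n K.≈ K.0#) → (∀ k → k < k₀ → F k n K.≈ K.0#) →
                     ∀ s → WeightedOrder s Fₜ (+ k₀ *ℤ + M +ℤ sum-min-valuation s root-valuation)
  weightedOrder-Fₜ k₀ Fₖ₀≉0 below-k₀ s = weightedOrder-cong (proj₂ (proj₂ factorization))
    (weightedOrder-mulS nonzero-* (+ k₀ *ℤ + M) (spread-vanishesBelow E (Fₓ n) (+ k₀) fₙ-vanishesBelow)
      (λ e → φ-≉0 Fₖ₀≉0 (L.trans (L.sym (coefAt-Fₜ k₀ n)) e))
      (weightedOrder-prodLin (proj₁ (proj₁ extension)) nonzero-* s roots root-valuation))
    where
    fₙ-vanishesBelow : VanishesBelow (Fₓ n) (+ k₀)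
    fₙ-vanishesBelow z z<k₀ with position (Fₓ n) z
    ... | below z<0 = coefAt-below-low (Fₓ n) z z<0
    ... | at k P.refl = L.trans (L.reflexive (coefAt-low+ (Fₓ n) k))
                                (φ-≈0 (below-k₀ k (ℤP.drop‿+<+ z<k₀)))

  -- With Y of weight ω·M, the t-exponent of x^i Y^j is (i + ω·j)·M.
  weightedOrder⇒minimalWeight : ∀ ω {w m} → WeightedOrder (+ (ω ℕ.* M)) Fₜ w → HasMinimalWeight ω F m →
                                w ≡ + (m ℕ.* M)
  weightedOrder⇒minimalWeight ω {w} {m} R ((i , j , weight≡m , Fᵢⱼ≉0) , least) = ℤP.≤-antisym w≤mM mM≤w
    where
    open WeightedOrder R
    s = + (ω ℕ.* M)
    weight : ∀ i j → + ((i ℕ.+ ω ℕ.* j) ℕ.* M) ≡ + i *ℤ + M +ℤ s *ℤ + j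
    weight i j = P.trans (ℤP.pos-* (i ℕ.+ ω ℕ.* j) M) (P.trans (P.cong (_*ℤ + M) (P.trans (ℤP.pos-+ i (ω ℕ.* j))
                   (P.cong (+ i +ℤ_) (ℤP.pos-* ω j)))) (P.trans (by-ring (+ i) (+ ω) (+ j) (+ M))
                   (P.cong (λ t → + i *ℤ + M +ℤ t *ℤ + j) (P.sym (ℤP.pos-* ω M)))))
      where
      by-ring : ∀ i ω j M → (i +ℤ ω *ℤ j) *ℤ M ≡ i *ℤ M +ℤ (ω *ℤ M) *ℤ j
      by-ring = solve-∀
    line+ : ∀ j → lineAt s w j +ℤ s *ℤ + j ≡ w
    line+ j = by-ring w s (+ j)
      where
      by-ring : ∀ w s j → (w -ℤ s *ℤ j) +ℤ s *ℤ j ≡ w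
      by-ring = solve-∀
    w≤mM : w ≤ℤ + (m ℕ.* M)
    w≤mM = P.subst₂ _≤ℤ_ (line+ j) (P.trans (P.sym (weight i j)) (P.cong (λ t → + (t ℕ.* M)) weight≡m))
             (ℤP.+-monoˡ-≤ (s *ℤ + j) (ℤP.≮⇒≥ λ lt → φ-≉0 Fᵢⱼ≉0 (L.trans (L.sym (coefAt-Fₜ i j)) (bound j (+ i *ℤ + M) lt))))
    mM≤w : + (m ℕ.* M) ≤ℤ w
    mM≤w with Fₜ-nonzero⇒ top (lineAt s w top) (λ e → leading≉0 (L.trans (L.sym leading-at-top) e))
    ... | i′ , line≡ , Fᵢ′≉0 =
      P.subst (+ (m ℕ.* M) ≤ℤ_) (P.trans (weight i′ top) (P.trans (P.cong (_+ℤ s *ℤ + top) (P.sym line≡)) (line+ top)))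
              (Z.+≤+ (ℕP.*-monoˡ-≤ M (least i′ top Fᵢ′≉0)))

  order≡sum-of-contributions : ∀ r → IsOrderAtOrigin K F r →
    ∀ k₀ → ¬ (F k₀ n K.≈ K.0#) → (∀ k → k < k₀ → F k n K.≈ K.0#) → ∀ j₀ → ¬ (F 0 j₀ K.≈ K.0#) →
    + r / 1 ≡ sumFinℚ (λ i → contribution (e i) (κ i))
  order≡sum-of-contributions r order k₀ Fₖ₀≉0 below-k₀ j₀ F₀ⱼ₀≉0 =
    P.trans (/-cross (+ r) (+ r *ℤ + suc d) 0 d (P.sym (ℤP.*-identityʳ _)))
            (P.trans (P.cong (_/ suc d) (P.sym sum-G)) (P.sym (sumFinℚ-/ _ G d contribution≡G/D)))
    where
    d = ℕ.pred E
    E≡ : E ≡ suc d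
    E≡ = P.sym (ℕP.suc-pred E {{ℕ.>-nonZero (prodFinℕ-positive e (λ i → proj₁ (proj₁ factorization i)))}})
    M≡ : 1 ℕ.* M ≡ suc d
    M≡ = P.trans (ℕP.*-identityˡ M) (P.cong spreadFactor E≡)

    W : ℤ → ℤ
    W s = sum-min-valuation s root-valuation
    v = + k₀ *ℤ + M
    order-at-M : v +ℤ W (+ (1 ℕ.* M)) ≡ + (r ℕ.* M)
    order-at-M = weightedOrder⇒minimalWeight 1 (weightedOrder-Fₜ k₀ Fₖ₀≉0 below-k₀ (+ (1 ℕ.* M)))
                   (CharacteristicZeroField.order⇒minimalWeight K fieldK char0 F r order)
    order-at-0 : v +ℤ W (+ 0) ≡ + 0
    order-at-0 = weightedOrder⇒minimalWeight 0 (weightedOrder-Fₜ k₀ Fₖ₀≉0 below-k₀ (+ 0)) (minimalWeight-zero F j₀ F₀ⱼ₀≉0)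

    G : Fin n → ℤ
    G i = min-valuation (+ (1 ℕ.* M)) (root-valuation i) -ℤ min-valuation (+ 0) (root-valuation i)
    sum-G : sum G ≡ + r *ℤ + suc d
    sum-G = P.trans (sum-minus (λ i → min-valuation (+ (1 ℕ.* M)) (root-valuation i)) (λ i → min-valuation (+ 0) (root-valuation i)))
              (P.trans (by-ring v (W (+ (1 ℕ.* M))) (W (+ 0)))
              (P.trans (P.cong₂ _-ℤ_ order-at-M order-at-0)
              (P.trans (ℤP.+-identityʳ _) (P.trans (ℤP.pos-* r M) (P.cong (λ t → + r *ℤ + t) (P.cong spreadFactor E≡))))))
      where
      by-ring : ∀ v a b → a -ℤ b ≡ (v +ℤ a) -ℤ (v +ℤ b)
      by-ring = solve-∀
    contribution≡G/D : ∀ i → contribution (e i) (κ i) ≡ G i / suc d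
    contribution≡G/D i =
      P.trans (contribution-as-fraction (e i) q d (≡*spreadFactor-quot (e i) E d E≡ (∣prodFinℕ e i)) (κ i))
              (P.cong (_/ suc d) (P.cong₂ _-ℤ_
                (P.sym (P.trans (min-valuation-spread-rootSer _ (quot E (e i)) (κ i) (a i) _)
                                (P.cong (λ t → minScaled (+ t) q (κ i)) M≡)))
                (P.sym (min-valuation-spread-rootSer _ (quot E (e i)) (κ i) (a i) _))))
      where q = spreadFactor (quot E (e i))

proposition2p6 :
    ∀ {c₁ ℓ₁ c₂ ℓ₂} (K : CommutativeRing c₁ ℓ₁) (L : CommutativeRing c₂ ℓ₂) →
    IsField K → CharacteristicZero K →
    (φ : CommutativeRing.Carrier K → CommutativeRing.Carrier L) →
    IsFiniteFieldExtension K L φ →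
    (n : ℕ) (F : Coeffs2 K) →
    -- F is a polynomial of Y-degree n
    (∃ λ D → ∀ i j → (D < i ⊎ n < j) → CommutativeRing._≈_ K (F i j) (CommutativeRing.0# K)) →
    ¬ (∀ i → CommutativeRing._≈_ K (F i n) (CommutativeRing.0# K)) →
    -- F(0,Y) is not identically 0
    ¬ (∀ j → CommutativeRing._≈_ K (F 0 j) (CommutativeRing.0# K)) →
    (e : Fin n → ℕ) (κ : Fin n → Maybe ℤ) (a : Fin n → ℕ → CommutativeRing.Carrier L) →
    IsPuiseuxFactorization K L φ n F e κ a →
    (r : ℕ) → IsOrderAtOrigin K F r →
    (+ r / 1) ≡ sumFinℚ (λ i → contribution (e i) (κ i))
proposition2p6 K L fieldK char0 φ extension n F (D , degree) fₙ≢0 F[0,Y]≢0 e κ a factorization r order =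
  decidable-stable (+ r / 1 ℚ.≟ sumFinℚ (λ i → contribution (e i) (κ i))) λ r≢sum →
  least-counterexample (λ k → F k n ≈ 0#) fₙ≢0 D (λ k D<k → degree k n (inj₁ D<k)) λ { (k₀ , Fₖ₀≉0 , below-k₀) →
  least-counterexample (λ j → F 0 j ≈ 0#) F[0,Y]≢0 n (λ j n<j → degree 0 j (inj₂ n<j)) λ { (j₀ , F₀ⱼ₀≉0 , _) →
  r≢sum (Puiseux.order≡sum-of-contributions K L fieldK char0 φ extension n F e κ a factorization
           r order k₀ Fₖ₀≉0 below-k₀ j₀ F₀ⱼ₀≉0) } }
  where open CommutativeRing K using (_≈_; 0#)
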